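{- Let $q\equiv 3\pmod 4$ be a prime power. The Paley oriented two-graph $g_q$ is isomorphic to the oriented two-graph $g$ on the projective line $\mathbb{P}^1\mathbb{F}_q$ given by $$g(\mathbf{x},\mathbf{y},\mathbf{z})=\chi\big(\det(\mathbf{x}:\mathbf{y})\det(\mathbf{y}:\mathbf{z})\det(\mathbf{z}:\mathbf{x})\big);$$ in particular this $g$ is well defined, i.e. independent of the choice of representatives of $\mathbf{x},\mathbf{y},\mathbf{z}$.
   Context: $\chi:\mathbb{F}_q\to\{0,\pm1\}$ is given by $\chi(0)=0$, $\chi(x)=1$ if $x$ is a nonzero square and $\chi(x)=-1$ otherwise. The Paley tournament $T_\chi$ has vertex set $\mathbb{F}_q$ with $(x,y)$ an edge iff $\chi(y-x)=1$. For a tournament $T$, its augmentation $T^+$ has vertex set $V(T)\cup\{\infty\}$, restricts to $T$ on $V(T)$, and has $(x,\infty)$ as an edge for every $x\in V(T)$. For a tournament $T$ encoded by $e_T(x,y)=\pm1$ ($+1$ iff $(x,y)$ is an edge), $g_T(x,y,z)=e_T(x,y)e_T(y,z)e_T(z,x)$. The Paley oriented two-graph is $g_q:=g_{T_\chi^+}$. An oriented two-graph on $V$ is an alternating $\{\pm1\}$-valued function on triples of distinct elements satisfying $g(x,y,z)g(y,x,w)g(z,y,w)g(x,z,w)=1$ for distinct $x,y,z,w$; two oriented two-graphs $h$ on $W$ and $g$ on $V$ are isomorphic if there is a bijection $\phi:W\to V$ with $g(\phi x,\phi y,\phi z)=h(x,y,z)$. $\mathbb{P}^1\mathbb{F}_q$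 is the set of nonzero pairs $(x_1,x_2)\in\mathbb{F}_q^2$ modulo nonzero scalars, and $\det(\mathbf{x}:\mathbf{y})=x_1y_2-x_2y_1$. -}

module Defs where

open import Level using (0ℓ)
open import Data.Nat using (ℕ; _^_)
open import Data.Nat.Primality using (Prime)
open import Data.Fin using (Fin)
import Data.Fin as Fin
import Data.Fin.Properties as FinP
open import Data.Integer using (ℤ; 0ℤ; 1ℤ; -1ℤ) renaming (_*_ to _*ℤ_)
open import Data.Maybe using (Maybe; just; nothing)
open import Data.Product using (Σ; ∃; _×_; _,_; proj₁; proj₂)
open import Function.Bundles using (_↔_; Inverse)
open import Algebra.Core using (Op₁; Op₂)
open import Algebra.Structures using (IsCommutativeRing)
open import Relation.Nullary using (¬_; Dec; yes; no)
open import Relation.Binary.Definitions using (DecidableEquality)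
open import Relation.Binary.PropositionalEquality
  using (_≡_; _≢_; refl; sym; trans; cong)

IsPrimePower : ℕ → Set
IsPrimePower q = Σ ℕ λ p → Σ ℕ λ k → Prime p × (q ≡ p ^ Data.Nat.suc k)
  where import Data.Nat

record FiniteField : Set₁ where
  field
    Carrier : Set
    _+_ _*_ : Op₂ Carrier
    -_      : Op₁ Carrier
    0# 1#   : Carrier
    isCommutativeRing : IsCommutativeRing _≡_ _+_ _*_ -_ 0# 1#
    0≢1     : 0# ≢ 1#
    inv     : ∀ x → x ≢ 0# → Σ Carrier λ y → x * y ≡ 1#
    size    : ℕ
    enum    : Carrier ↔ Fin size

  infixl 7 _*_
  infixl 6 _+_ _-_
  infix  8 -_

  _-_ : Op₂ Carrier
  x - y = x + (- y)

  _≟_ : DecidableEquality Carrier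
  x ≟ y with Inverse.to enum x FinP.≟ Inverse.to enum y
  ... | yes p = yes (trans (sym (Inverse.strictlyInverseʳ enum x))
                      (trans (cong (Inverse.from enum) p) (Inverse.strictlyInverseʳ enum y)))
  ... | no ¬p = no λ e → ¬p (cong (Inverse.to enum) e)

  IsSquare : Carrier → Set
  IsSquare x = ∃ λ y → y * y ≡ x

  isSquare? : ∀ x → Dec (IsSquare x)
  isSquare? x with FinP.any? {P = λ i → Inverse.from enum i * Inverse.from enum i ≡ x}
                     (λ i → (Inverse.from enum i * Inverse.from enum i) ≟ x)
  ... | yes (i , p) = yes (Inverse.from enum i , p)
  ... | no ¬p = no λ { (y , p) → ¬p (Inverse.to enum y ,
          trans (cong (λ z → z * z) (Inverse.strictlyInverseʳ enum y)) p) }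

  χ : Carrier → ℤ
  χ x with x ≟ 0#
  ... | yes _ = 0ℤ
  ... | no _ with isSquare? x
  ... | yes _ = 1ℤ
  ... | no _ = -1ℤ

  ePaley : Carrier → Carrier → ℤ
  ePaley x y = χ (y - x)

  -- augmented tournament T_χ⁺ on F_q ∪ {∞}; ∞ is `nothing`
  ePaley⁺ : Maybe Carrier → Maybe Carrier → ℤ
  ePaley⁺ (just x) (just y) = ePaley x y
  ePaley⁺ (just x) nothing  = 1ℤ
  ePaley⁺ nothing  (just y) = -1ℤ
  ePaley⁺ nothing  nothing  = 0ℤ   -- never used (vertices are distinct)

  gPaley : Maybe Carrier → Maybe Carrier → Maybe Carrier → ℤ
  gPaley x y z = ePaley⁺ x y *ℤ ePaley⁺ y z *ℤ ePaley⁺ z x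

  -- Projective line P¹F_q as the setoid of nonzero pairs modulo scalars

  NZPair : Set
  NZPair = Σ (Carrier × Carrier) λ v → ¬ (proj₁ v ≡ 0# × proj₂ v ≡ 0#)

  _∼_ : NZPair → NZPair → Set
  ((x₁ , x₂) , _) ∼ ((y₁ , y₂) , _) =
    Σ Carrier λ c → c ≢ 0# × (y₁ ≡ c * x₁ × y₂ ≡ c * x₂)

  det : NZPair → NZPair → Carrier
  det ((x₁ , x₂) , _) ((y₁ , y₂) , _) = x₁ * y₂ - x₂ * y₁

  gProj : NZPair → NZPair → NZPair → ℤ
  gProj x y z = χ (det x y * det y z * det z x)

-- The point of P¹F_q with representative (u , −1) goes to u ∈ F_q and the one with representative
-- (1 , 0) goes to ∞. For these representatives det (rep a) (rep b) equals b − a, 1, −1 or 0 according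
-- as a, b are both finite, only a is finite, only b is finite, or a = b = ∞; since χ(−1) = −1 for
-- q ≡ 3 (mod 4), χ of this determinant is the edge sign of T_χ⁺, and multiplicativity of χ turns g_q
-- into g on representatives. Rescaling the representatives by c, d, e multiplies the product of the
-- three determinants by the nonzero square (c d e)², so g is well defined.
--
-- Multiplicativity of χ and χ(−1) = −1 are proved by counting. Squaring is two-to-one on F_q^×, so
-- there are as many nonsquares as nonzero squares; multiplication by a nonsquare maps the nonzero
-- squares injectively into the nonsquares, hence onto them, so it maps no nonsquare to a nonsquare.
-- If −1 were a square, negation would pair off the nonzero squares and q − 1 would be divisible by 4.

module Submission where

open import Defs
open import Level using (0ℓ)
open import Algebra.Bundles using (CommutativeRing)
open import Algebra.Solver.Ring.AlmostCommutativeRing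
  using (fromCommutativeRing; _-Raw-AlmostCommutative⟶_)
open import Data.Nat.Base as ℕ using (ℕ; zero; suc)
import Data.Nat.Properties as ℕ
open import Algebra.Properties.Semiring.Sum ℕ.+-*-semiring
  using (sum; sum-cong-≗; ∑-distrib-+; sum-replicate-zero; ∑-comm; ∑-permute; *-distribˡ-sum)
open import Data.Nat.DivMod using (_%_; m∣n⇒o%n%m≡o%m; m*n%n≡0; [m+kn]%n≡m%n)
open import Data.Nat.Divisibility using (divides)
open import Data.Integer.Base as ℤ using (ℤ; +_; -[1+_]; _⊖_; 0ℤ; 1ℤ; -1ℤ)
import Data.Integer.Properties as ℤ
open import Data.Fin.Base using (Fin; zero; suc)
import Data.Fin.Properties as Fin
open import Data.Maybe.Base as Maybe using (Maybe; just; nothing)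
open import Data.Product.Base using (Σ; ∃; _×_; _,_; proj₁; proj₂)
open import Data.Sum.Base as Sum using (_⊎_; inj₁; inj₂; [_,_])
open import Data.Unit.Base using (tt)
open import Data.Vec.Functional using (Vector)
open import Function.Base using (_∘_)
open import Function.Bundles using (_↔_; Inverse; mk↔ₛ′)
open import Function.Construct.Composition using (_↔-∘_)
open import Function.Construct.Symmetry using (↔-sym)
open import Relation.Binary.Definitions using (DecidableEquality)
open import Relation.Binary.PropositionalEquality
  using (_≡_; _≢_; refl; sym; trans; cong; cong₂; subst; module ≡-Reasoning)
open import Relation.Nullary using (¬_; Dec; yes; no; contradiction; map′; _⊎-dec_; _×-dec_; ¬?)
open import Relation.Nullary.Decidable using (dec⇒maybe)
open import Relation.Unary using (Pred; Decidable; U; ∁; _∪_; _∩_; _⊆_; _≐_; _⊥_)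
open import Relation.Unary.Properties using (U?; _∪?_; _∩?_; ∁?)

-- Tactic.RingSolver cannot see through the record projections of FiniteField, and a finite field
-- has no computable equality to normalise its own constants, so the solver runs over ℤ.

module ℤ-CoefficientRingSolver {c ℓ} (R : CommutativeRing c ℓ) where
  open CommutativeRing R
    renaming (refl to ≈-refl; sym to ≈-sym; trans to ≈-trans; reflexive to ≈-reflexive)
  open import Algebra.Properties.Semiring.Mult.TCOptimised semiring using (×-homo-+; ×1-homo-*; 1+×)
    renaming (_×_ to _×′_)
  open import Algebra.Properties.Ring ring using (-‿involutive; -0#≈0#; -‿distribˡ-*; -‿distribʳ-*)
  open import Algebra.Properties.AbelianGroup +-abelianGroup using (⁻¹-∙-comm; xyx⁻¹≈y)
  open import Relation.Binary.Reasoning.Setoid setoid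

  private
    -- The optimised _×′_ makes ⟦ 1ℤ ⟧ reduce to 1#, so that con 1ℤ stands for 1# in equations.
    ⟦_⟧ : ℤ → Carrier
    ⟦ + n ⟧      = n ×′ 1#
    ⟦ -[1+ n ] ⟧ = - (suc n ×′ 1#)

    -‿homo : ∀ i → ⟦ ℤ.- i ⟧ ≈ - ⟦ i ⟧
    -‿homo (+ zero)  = ≈-sym -0#≈0#
    -‿homo (+ suc n) = ≈-refl
    -‿homo -[1+ n ]  = ≈-sym (-‿involutive _)

    ⊖-homo : ∀ m n → ⟦ m ⊖ n ⟧ ≈ m ×′ 1# - n ×′ 1#
    ⊖-homo m       zero    = ≈-sym (≈-trans (+-congˡ -0#≈0#) (+-identityʳ _))
    ⊖-homo zero    (suc n) = ≈-sym (+-identityˡ _)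
    ⊖-homo (suc m) (suc n) = begin
      ⟦ suc m ⊖ suc n ⟧                  ≡⟨ cong ⟦_⟧ (ℤ.[1+m]⊖[1+n]≡m⊖n m n) ⟩
      ⟦ m ⊖ n ⟧                          ≈⟨ ⊖-homo m n ⟩
      m ×′ 1# - n ×′ 1#                  ≈⟨ xyx⁻¹≈y 1# (m ×′ 1# - n ×′ 1#) ⟨
      1# + (m ×′ 1# - n ×′ 1#) - 1#      ≈⟨ +-congʳ (+-assoc 1# _ _) ⟨
      1# + m ×′ 1# - n ×′ 1# - 1#        ≈⟨ +-assoc _ _ _ ⟩
      1# + m ×′ 1# + (- (n ×′ 1#) - 1#)  ≈⟨ +-congˡ (+-comm _ _) ⟩
      1# + m ×′ 1# + (- 1# - n ×′ 1#)    ≈⟨ +-congˡ (⁻¹-∙-comm 1# (n ×′ 1#)) ⟩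
      1# + m ×′ 1# - (1# + n ×′ 1#)      ≈⟨ +-cong (1+× m 1#) (-‿cong (1+× n 1#)) ⟨
      suc m ×′ 1# - suc n ×′ 1#          ∎

    +-homo : ∀ i j → ⟦ i ℤ.+ j ⟧ ≈ ⟦ i ⟧ + ⟦ j ⟧
    +-homo (+ m)     (+ n)     = ×-homo-+ 1# m n
    +-homo (+ m)     -[1+ n ]  = ⊖-homo m (suc n)
    +-homo -[1+ m ]  (+ n)     = ≈-trans (⊖-homo n (suc m)) (+-comm _ _)
    +-homo -[1+ m ]  -[1+ n ]  = begin
      - (suc (suc (m ℕ.+ n)) ×′ 1#)     ≡⟨ cong (λ k → - (k ×′ 1#)) (ℕ.+-suc (suc m) n) ⟨
      - ((suc m ℕ.+ suc n) ×′ 1#)       ≈⟨ -‿cong (×-homo-+ 1# (suc m) (suc n)) ⟩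
      - (suc m ×′ 1# + suc n ×′ 1#)      ≈⟨ ⁻¹-∙-comm _ _ ⟨
      - (suc m ×′ 1#) - suc n ×′ 1#      ∎

    +*+-homo : ∀ m n → ⟦ + m ℤ.* + n ⟧ ≈ m ×′ 1# * n ×′ 1#
    +*+-homo m n = ≈-trans (≈-reflexive (cong ⟦_⟧ (sym (ℤ.pos-* m n)))) (×1-homo-* m n)

    +*-homo : ∀ m j → ⟦ + m ℤ.* j ⟧ ≈ m ×′ 1# * ⟦ j ⟧
    +*-homo m (+ n)     = +*+-homo m n
    +*-homo m -[1+ n ]  = begin
      ⟦ + m ℤ.* ℤ.- + suc n ⟧          ≡⟨ cong ⟦_⟧ (ℤ.neg-distribʳ-* (+ m) (+ suc n)) ⟨
      ⟦ ℤ.- (+ m ℤ.* + suc n) ⟧        ≈⟨ -‿homo (+ m ℤ.* + suc n) ⟩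
      - ⟦ + m ℤ.* + suc n ⟧            ≈⟨ -‿cong (+*+-homo m (suc n)) ⟩
      - (m ×′ 1# * suc n ×′ 1#)          ≈⟨ -‿distribʳ-* _ _ ⟩
      m ×′ 1# * - (suc n ×′ 1#)          ∎

    *-homo : ∀ i j → ⟦ i ℤ.* j ⟧ ≈ ⟦ i ⟧ * ⟦ j ⟧
    *-homo (+ m)    j = +*-homo m j
    *-homo -[1+ m ] j = begin
      ⟦ ℤ.- + suc m ℤ.* j ⟧            ≡⟨ cong ⟦_⟧ (ℤ.neg-distribˡ-* (+ suc m) j) ⟨
      ⟦ ℤ.- (+ suc m ℤ.* j) ⟧          ≈⟨ -‿homo (+ suc m ℤ.* j) ⟩
      - ⟦ + suc m ℤ.* j ⟧              ≈⟨ -‿cong (+*-homo (suc m) j) ⟩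
      - (suc m ×′ 1# * ⟦ j ⟧)           ≈⟨ -‿distribˡ-* _ _ ⟩
      - (suc m ×′ 1#) * ⟦ j ⟧           ∎

    homomorphism : ℤ.+-*-rawRing -Raw-AlmostCommutative⟶ fromCommutativeRing R
    homomorphism = record
      { ⟦_⟧ = ⟦_⟧ ; +-homo = +-homo ; *-homo = *-homo ; -‿homo = -‿homo
      ; 0-homo = ≈-refl ; 1-homo = ≈-refl }

  open import Algebra.Solver.Ring ℤ.+-*-rawRing (fromCommutativeRing R) homomorphism
    (λ i j → Maybe.map (≈-reflexive ∘ cong ⟦_⟧) (dec⇒maybe (i ℤ.≟ j)))
    public using (solve; _:+_; _:*_; :-_; _:-_; _:=_; con)

indicator : ∀ {p} {P : Set p} → Dec P → ℕ
indicator (yes _) = 1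
indicator (no _)  = 0

module _ {p q} {P : Set p} {Q : Set q} where

  open import Data.Nat.Base using (_+_; _*_; _≤_; z≤n)

  indicator-⇔ : (P → Q) → (Q → P) → (P? : Dec P) (Q? : Dec Q) → indicator P? ≡ indicator Q?
  indicator-⇔ _   _   (yes _) (yes _) = refl
  indicator-⇔ P→Q _   (yes p) (no ¬q) = contradiction (P→Q p) ¬q
  indicator-⇔ _   Q→P (no ¬p) (yes q) = contradiction (Q→P q) ¬p
  indicator-⇔ _   _   (no _)  (no _)  = refl

  indicator-mono : (P → Q) → (P? : Dec P) (Q? : Dec Q) → indicator P? ≤ indicator Q?
  indicator-mono _   (yes _) (yes _) = ℕ.≤-refl
  indicator-mono P→Q (yes p) (no ¬q) = contradiction (P→Q p) ¬q
  indicator-mono _   (no _)  _       = z≤n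

  indicator-⊎ : ¬ (P × Q) → (P? : Dec P) (Q? : Dec Q) →
                indicator (P? ⊎-dec Q?) ≡ indicator P? + indicator Q?
  indicator-⊎ P∩Q=∅ (yes p) (yes q) = contradiction (p , q) P∩Q=∅
  indicator-⊎ _     (yes _) (no _)  = refl
  indicator-⊎ _     (no _)  (yes _) = refl
  indicator-⊎ _     (no _)  (no _)  = refl

  indicator-× : (P? : Dec P) (Q? : Dec Q) → indicator (P? ×-dec Q?) ≡ indicator P? * indicator Q?
  indicator-× (yes _) (yes _) = refl
  indicator-× (yes _) (no _)  = refl
  indicator-× (no _)  _       = refl

module _ where

  open import Data.Nat.Base using (_+_; _≤_; z≤n)

  sum-mono-≤ : ∀ {n} {f g : Vector ℕ n} → (∀ i → f i ≤ g i) → sum f ≤ sum g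
  sum-mono-≤ {zero}  _   = z≤n
  sum-mono-≤ {suc n} f≤g = ℕ.+-mono-≤ (f≤g zero) (sum-mono-≤ (f≤g ∘ suc))

  sum-indicator-≡ : ∀ {n} (j : Fin n) → sum (λ i → indicator (j Fin.≟ i)) ≡ 1
  sum-indicator-≡ {suc n} zero    = cong suc (sum-replicate-zero n)
  sum-indicator-≡ {suc n} (suc j) = trans
    (sum-cong-≗ λ i → indicator-⇔ Fin.suc-injective (cong suc) (suc j Fin.≟ suc i) (j Fin.≟ i))
    (sum-indicator-≡ j)

  sum-replicate-one : ∀ n → sum {n} (λ _ → 1) ≡ n
  sum-replicate-one zero    = refl
  sum-replicate-one (suc n) = cong suc (sum-replicate-one n)

module Counting {A : Set} {n : ℕ} (enum : A ↔ Fin n) (_≟_ : DecidableEquality A) where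

  open import Data.Nat.Base using (_+_; _*_; _≤_)

  open Inverse enum using (to; from; strictlyInverseˡ; strictlyInverseʳ)

  ∑ : (A → ℕ) → ℕ
  ∑ f = sum (f ∘ from)

  count : {P : Pred A 0ℓ} → Decidable P → ℕ
  count P? = ∑ (indicator ∘ P?)

  ∃? : {P : Pred A 0ℓ} → Decidable P → Dec (∃ P)
  ∃? {P} P? = map′ (λ (i , p) → from i , p)
    (λ (x , p) → to x , subst P (sym (strictlyInverseʳ x)) p) (Fin.any? (P? ∘ from))

  ∑-cong : {f g : A → ℕ} → (∀ x → f x ≡ g x) → ∑ f ≡ ∑ g
  ∑-cong f≗g = sum-cong-≗ (f≗g ∘ from)

  module _ {P Q : Pred A 0ℓ} (P? : Decidable P) (Q? : Decidable Q) where

    count-≐ : P ≐ Q → count P? ≡ count Q?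
    count-≐ (P⊆Q , Q⊆P) = ∑-cong λ x → indicator-⇔ P⊆Q Q⊆P (P? x) (Q? x)

    count-mono : P ⊆ Q → count P? ≤ count Q?
    count-mono P⊆Q = sum-mono-≤ λ i → indicator-mono P⊆Q (P? (from i)) (Q? (from i))

    count-∪ : P ⊥ Q → count (P? ∪? Q?) ≡ count P? + count Q?
    count-∪ P⊥Q = trans (∑-cong λ x → indicator-⊎ P⊥Q (P? x) (Q? x))
      (∑-distrib-+ (indicator ∘ P? ∘ from) (indicator ∘ Q? ∘ from))

  count-U : count U? ≡ n
  count-U = sum-replicate-one n

  count-∅ : {P : Pred A 0ℓ} (P? : Decidable P) → (∀ x → ¬ P x) → count P? ≡ 0
  count-∅ P? ∅ = trans (∑-cong λ x → indicator-⇔ (∅ x) (λ ()) (P? x) (no λ ())) (sum-replicate-zero n)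

  count-singleton : ∀ a → count (a ≟_) ≡ 1
  count-singleton a = trans (sum-cong-≗ λ i → indicator-⇔
      (λ a≡x → trans (cong to a≡x) (strictlyInverseˡ i))
      (λ to-a≡i → trans (sym (strictlyInverseʳ a)) (cong from to-a≡i))
      (a ≟ from i) (to a Fin.≟ i))
    (sum-indicator-≡ (to a))

  count-↔ : {P : Pred A 0ℓ} (P? : Decidable P) (σ : A ↔ A) → count (P? ∘ Inverse.to σ) ≡ count P?
  count-↔ P? σ = sym (trans (∑-permute (indicator ∘ P? ∘ from) (enum ↔-∘ (σ ↔-∘ ↔-sym enum)))
    (sum-cong-≗ λ i → cong (indicator ∘ P?) (strictlyInverseʳ (Inverse.to σ (from i)))))

  count-pair : {P : Pred A 0ℓ} (P? : Decidable P) {a b : A} → a ≢ b →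
               P ≐ (a ≡_) ∪ (b ≡_) → count P? ≡ 2
  count-pair P? {a} {b} a≢b P≐a∪b = begin
    count P?                     ≡⟨ count-≐ P? ((a ≟_) ∪? (b ≟_)) P≐a∪b ⟩
    count ((a ≟_) ∪? (b ≟_))     ≡⟨ count-∪ (a ≟_) (b ≟_) (λ (a≡x , b≡x) → a≢b (trans a≡x (sym b≡x))) ⟩
    count (a ≟_) + count (b ≟_)  ≡⟨ cong₂ _+_ (count-singleton a) (count-singleton b) ⟩
    2                            ∎
    where open ≡-Reasoning

  count-fibres : {P : Pred A 0ℓ} (P? : Decidable P) (s : A → A) →
                 count P? ≡ ∑ λ y → count (P? ∩? λ x → s x ≟ y)
  count-fibres P? s = begin
    count P?
      ≡⟨ ∑-cong (λ x → trans (sym (ℕ.*-identityʳ (indicator (P? x))))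
                            (cong (indicator (P? x) *_) (sym (count-singleton (s x))))) ⟩
    ∑ (λ x → indicator (P? x) * count (s x ≟_))
      ≡⟨ ∑-cong (λ x → *-distribˡ-sum (indicator (P? x)) (λ j → indicator (s x ≟ from j))) ⟩
    ∑ (λ x → ∑ λ y → indicator (P? x) * indicator (s x ≟ y))
      ≡⟨ ∑-comm (λ i j → indicator (P? (from i)) * indicator (s (from i) ≟ from j)) ⟩
    ∑ (λ y → ∑ λ x → indicator (P? x) * indicator (s x ≟ y))
      ≡⟨ ∑-cong (λ y → ∑-cong (λ x → sym (indicator-× (P? x) (s x ≟ y)))) ⟩
    ∑ (λ y → count (P? ∩? λ x → s x ≟ y)) ∎
    where open ≡-Reasoning

  Image : Pred A 0ℓ → (A → A) → Pred A 0ℓ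
  Image P s y = ∃ λ x → P x × s x ≡ y

  image? : {P : Pred A 0ℓ} → Decidable P → (s : A → A) → Decidable (Image P s)
  image? P? s y = ∃? (P? ∩? λ x → s x ≟ y)

  count-two-to-one : {P : Pred A 0ℓ} (P? : Decidable P) (s σ : A → A) →
    (∀ {x} → P x → P (σ x)) → (∀ {x} → P x → σ x ≢ x) → (∀ {x} → P x → s (σ x) ≡ s x) →
    (∀ {x y} → P x → P y → s y ≡ s x → x ≡ y ⊎ σ x ≡ y) →
    count P? ≡ 2 * count (image? P? s)
  count-two-to-one {P} P? s σ P-σ σ-fixes-nothing s-σ s-fibre =
    trans (count-fibres P? s) (trans (∑-cong fibre-size) (sym (*-distribˡ-sum 2 (indicator ∘ image? P? s ∘ from))))
    where
    fibre-size : ∀ y → count (P? ∩? λ x → s x ≟ y) ≡ 2 * indicator (image? P? s y)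
    fibre-size y with image? P? s y
    ... | yes (r , Pr , sr≡y) = count-pair (P? ∩? λ x → s x ≟ y) (σ-fixes-nothing Pr ∘ sym)
      ( (λ (Px , sx≡y) → s-fibre Pr Px (trans sx≡y (sym sr≡y)))
      , [ (λ { refl → Pr , sr≡y }) , (λ { refl → P-σ Pr , trans (s-σ Pr) sr≡y }) ] )
    ... | no ∄ = count-∅ (P? ∩? λ x → s x ≟ y) λ x (Px , sx≡y) → ∄ (x , Px , sx≡y)

module _ {m : ℕ} where

  open import Data.Nat.Base using (_+_; _*_)

  %4≡3⇒%2≡1 : m % 4 ≡ 3 → m % 2 ≡ 1
  %4≡3⇒%2≡1 m%4≡3 = trans (sym (m∣n⇒o%n%m≡o%m 2 4 m (divides 2 refl))) (cong (_% 2) m%4≡3)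

  %2≡1⇒≢2* : m % 2 ≡ 1 → ∀ k → m ≢ 2 * k
  %2≡1⇒≢2* m%2≡1 k m≡2k with trans (sym m%2≡1) (trans (cong (_% 2) (trans m≡2k (ℕ.*-comm 2 k))) (m*n%n≡0 k 2))
  ... | ()

  %4≡3⇒≢1+4* : m % 4 ≡ 3 → ∀ k → m ≢ 1 + 2 * (2 * k)
  %4≡3⇒≢1+4* m%4≡3 k m≡1+4k with trans (sym m%4≡3) (trans (cong (_% 4) m≡1+4k)
    (trans (cong (λ t → (1 + t) % 4) (trans (sym (ℕ.*-assoc 2 2 k)) (ℕ.*-comm 4 k))) ([m+kn]%n≡m%n 1 k 4)))
  ... | ()

module FieldProperties (F : FiniteField) where

  open FiniteField F

  commutativeRing : CommutativeRing 0ℓ 0ℓ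
  commutativeRing = record { isCommutativeRing = isCommutativeRing }

  open CommutativeRing commutativeRing public
    using (+-assoc; *-assoc; *-identityˡ; zeroˡ; zeroʳ; *-comm; ring)
  open import Algebra.Properties.Ring ring public
    using ( -‿involutive; -‿injective; -0#≈0#; -‿distribˡ-*; -1*x≈-x
          ; +-inverseˡ-unique; +-identityʳ-unique; x∙y⁻¹≈ε⇒x≈y)
  open ℤ-CoefficientRingSolver commutativeRing public

  1≢0 : 1# ≢ 0#
  1≢0 = 0≢1 ∘ sym

  -‿≢0 : ∀ {x} → x ≢ 0# → - x ≢ 0#
  -‿≢0 {x} x≢0 -x≡0 = x≢0 (trans (sym (-‿involutive x)) (trans (cong -_ -x≡0) -0#≈0#))

  -1≢0 : - 1# ≢ 0#
  -1≢0 = -‿≢0 1≢0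

  x*-1≡-x : ∀ x → x * - 1# ≡ - x
  x*-1≡-x x = trans (*-comm x (- 1#)) (-1*x≈-x x)

  x*y≡1⇒y*[x*z]≡z : ∀ {x y} → x * y ≡ 1# → ∀ z → y * (x * z) ≡ z
  x*y≡1⇒y*[x*z]≡z {x} {y} xy≡1 z = begin
    y * (x * z)  ≡⟨ solve 3 (λ x y z → y :* (x :* z) := (x :* y) :* z) refl x y z ⟩
    x * y * z    ≡⟨ cong (_* z) xy≡1 ⟩
    1# * z       ≡⟨ *-identityˡ z ⟩
    z            ∎
    where open ≡-Reasoning

  x*y≡1⇒y≢0 : ∀ {x y} → x * y ≡ 1# → y ≢ 0#
  x*y≡1⇒y≢0 {x} xy≡1 y≡0 = 1≢0 (trans (sym xy≡1) (trans (cong (x *_) y≡0) (zeroʳ x)))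

  zero-product : ∀ {a b} → a * b ≡ 0# → a ≡ 0# ⊎ b ≡ 0#
  zero-product {a} {b} ab≡0 with a ≟ 0#
  ... | yes a≡0 = inj₁ a≡0
  ... | no a≢0  = let (a⁻¹ , aa⁻¹≡1) = inv a a≢0 in
    inj₂ (trans (sym (x*y≡1⇒y*[x*z]≡z aa⁻¹≡1 b)) (trans (cong (a⁻¹ *_) ab≡0) (zeroʳ a⁻¹)))

  *-≢0 : ∀ {a b} → a ≢ 0# → b ≢ 0# → a * b ≢ 0#
  *-≢0 a≢0 b≢0 ab≡0 = [ a≢0 , b≢0 ] (zero-product ab≡0)

  x*x≡y*y⇒x≡y⊎x≡-y : ∀ {x y} → x * x ≡ y * y → x ≡ y ⊎ x ≡ - y
  x*x≡y*y⇒x≡y⊎x≡-y {x} {y} xx≡yy with zero-product (begin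
      (x - y) * (x + y)  ≡⟨ solve 2 (λ x y → (x :- y) :* (x :+ y) := x :* x :- y :* y) refl x y ⟩
      x * x - y * y      ≡⟨ cong (_- y * y) xx≡yy ⟩
      y * y - y * y      ≡⟨ solve 1 (λ a → a :- a := con 0ℤ) refl (y * y) ⟩
      0#                 ∎)
    where open ≡-Reasoning
  ... | inj₁ x-y≡0 = inj₁ (x∙y⁻¹≈ε⇒x≈y x y x-y≡0)
  ... | inj₂ x+y≡0 = inj₂ (+-inverseˡ-unique x y x+y≡0)

  multiplication-↔ : ∀ {a} → a ≢ 0# → Carrier ↔ Carrier
  multiplication-↔ {a} a≢0 = mk↔ₛ′ (a *_) (a⁻¹ *_)
    (x*y≡1⇒y*[x*z]≡z (trans (*-comm a⁻¹ a) aa⁻¹≡1)) (x*y≡1⇒y*[x*z]≡z aa⁻¹≡1)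
    where
    a⁻¹ = proj₁ (inv a a≢0)
    aa⁻¹≡1 = proj₂ (inv a a≢0)

  nonsquare≢0 : ∀ {x} → ¬ IsSquare x → x ≢ 0#
  nonsquare≢0 ¬sq refl = ¬sq (0# , zeroˡ 0#)

  root≢0 : ∀ {w x} → w * w ≡ x → x ≢ 0# → w ≢ 0#
  root≢0 ww≡x x≢0 refl = x≢0 (trans (sym ww≡x) (zeroˡ 0#))

  square*square : ∀ {a b} → IsSquare a → IsSquare b → IsSquare (a * b)
  square*square (v , vv≡a) (w , ww≡b) = v * w ,
    trans (solve 2 (λ v w → (v :* w) :* (v :* w) := (v :* v) :* (w :* w)) refl v w) (cong₂ _*_ vv≡a ww≡b)

  nonsquare*square : ∀ {a b} → ¬ IsSquare a → b ≢ 0# → IsSquare b → ¬ IsSquare (a * b)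
  nonsquare*square {a} {b} ¬sq b≢0 (w , ww≡b) (v , vv≡ab) = ¬sq (v * w⁻¹ , (begin
    (v * w⁻¹) * (v * w⁻¹)        ≡⟨ solve 2 (λ v k → (v :* k) :* (v :* k) := (v :* v) :* (k :* k)) refl v w⁻¹ ⟩
    (v * v) * (w⁻¹ * w⁻¹)        ≡⟨ cong (_* (w⁻¹ * w⁻¹)) (trans vv≡ab (cong (a *_) (sym ww≡b))) ⟩
    a * (w * w) * (w⁻¹ * w⁻¹)    ≡⟨ solve 3 (λ a w k → a :* (w :* w) :* (k :* k) := a :* ((w :* k) :* (w :* k))) refl a w w⁻¹ ⟩
    a * ((w * w⁻¹) * (w * w⁻¹))  ≡⟨ cong (λ t → a * (t * t)) ww⁻¹≡1 ⟩
    a * (1# * 1#)                ≡⟨ solve 1 (λ a → a :* (con 1ℤ :* con 1ℤ) := a) refl a ⟩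
    a                            ∎))
    where
    open ≡-Reasoning
    w⁻¹ = proj₁ (inv w (root≢0 ww≡b b≢0))
    ww⁻¹≡1 = proj₂ (inv w (root≢0 ww≡b b≢0))

  zero-square-or-nonsquare : ∀ x → x ≡ 0# ⊎ (x ≢ 0# × IsSquare x) ⊎ ¬ IsSquare x
  zero-square-or-nonsquare x with x ≟ 0# | isSquare? x
  ... | yes x≡0 | _       = inj₁ x≡0
  ... | no x≢0  | yes sq  = inj₂ (inj₁ (x≢0 , sq))
  ... | no _    | no ¬sq  = inj₂ (inj₂ ¬sq)

  χ-zero : ∀ {x} → x ≡ 0# → χ x ≡ 0ℤ
  χ-zero {x} x≡0 with x ≟ 0#
  ... | yes _   = refl
  ... | no x≢0  = contradiction x≡0 x≢0

  χ-square : ∀ {x} → x ≢ 0# → IsSquare x → χ x ≡ 1ℤ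
  χ-square {x} x≢0 sq with x ≟ 0#
  ... | yes x≡0 = contradiction x≡0 x≢0
  ... | no _ with isSquare? x
  ...   | yes _   = refl
  ...   | no ¬sq  = contradiction sq ¬sq

  χ-nonsquare : ∀ {x} → ¬ IsSquare x → χ x ≡ -1ℤ
  χ-nonsquare {x} ¬sq with x ≟ 0#
  ... | yes x≡0 = contradiction x≡0 (nonsquare≢0 ¬sq)
  ... | no _ with isSquare? x
  ...   | yes sq  = contradiction sq ¬sq
  ...   | no _    = refl

  χ-1 : χ 1# ≡ 1ℤ
  χ-1 = χ-square 1≢0 (1# , *-identityˡ 1#)

module QuadraticCharacter (F : FiniteField) (size%2≡1 : FiniteField.size F % 2 ≡ 1) where

  open FiniteField F
  open FieldProperties F
  open Counting enum _≟_

  nonzero? : Decidable (_≢ 0#)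
  nonzero? x = ¬? (x ≟ 0#)

  square? : Decidable ((_≢ 0#) ∩ IsSquare)
  square? = nonzero? ∩? isSquare?

  nonsquare? : Decidable (∁ IsSquare)
  nonsquare? = ∁? isSquare?

  size≡1+#nonzero : size ≡ 1 ℕ.+ count nonzero?
  size≡1+#nonzero = begin
    size                              ≡⟨ count-U ⟨
    count U?                          ≡⟨ count-≐ U? ((0# ≟_) ∪? nonzero?) (zero-or-nonzero , λ _ → tt) ⟩
    count ((0# ≟_) ∪? nonzero?)       ≡⟨ count-∪ (0# ≟_) nonzero? (λ (0≡x , x≢0) → x≢0 (sym 0≡x)) ⟩
    count (0# ≟_) ℕ.+ count nonzero?  ≡⟨ cong (ℕ._+ count nonzero?) (count-singleton 0#) ⟩
    1 ℕ.+ count nonzero?              ∎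
    where
    open ≡-Reasoning
    zero-or-nonzero : U ⊆ (0# ≡_) ∪ (_≢ 0#)
    zero-or-nonzero {x} _ with x ≟ 0#
    ... | yes x≡0 = inj₁ (sym x≡0)
    ... | no x≢0  = inj₂ x≢0

  -- In characteristic 2, x ↦ x + 1 pairs off the elements of each fibre of x ↦ x (x + 1).
  1+1≢0 : 1# + 1# ≢ 0#
  1+1≢0 2≡0 = %2≡1⇒≢2* size%2≡1 (count (image? U? s)) (trans (sym count-U)
      (count-two-to-one U? s (_+ 1#) (λ _ → tt) (λ _ → x+1≢x) (λ {x} _ → s[x+1]≡s[x] x)
                        (λ {x} {y} _ _ → fibre x y)))
    where
    open ≡-Reasoning
    s : Carrier → Carrier
    s x = x * (x + 1#)

    -a≡a : ∀ a → - a ≡ a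
    -a≡a a = sym (+-inverseˡ-unique a a (begin
      a + a          ≡⟨ solve 1 (λ a → a :+ a := (con 1ℤ :+ con 1ℤ) :* a) refl a ⟩
      (1# + 1#) * a  ≡⟨ cong (_* a) 2≡0 ⟩
      0# * a         ≡⟨ zeroˡ a ⟩
      0#             ∎))

    x+1≢x : ∀ {x} → x + 1# ≢ x
    x+1≢x {x} x+1≡x = 1≢0 (+-identityʳ-unique x 1# x+1≡x)

    s[x+1]≡s[x] : ∀ x → s (x + 1#) ≡ s x
    s[x+1]≡s[x] x = begin
      (x + 1#) * (x + 1# + 1#)    ≡⟨ cong ((x + 1#) *_) (+-assoc x 1# 1#) ⟩
      (x + 1#) * (x + (1# + 1#))  ≡⟨ cong (λ t → (x + 1#) * (x + t)) 2≡0 ⟩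
      (x + 1#) * (x + 0#)         ≡⟨ solve 1 (λ x → (x :+ con 1ℤ) :* (x :+ con 0ℤ) := x :* (x :+ con 1ℤ)) refl x ⟩
      x * (x + 1#)                ∎

    fibre : ∀ x y → s y ≡ s x → x ≡ y ⊎ x + 1# ≡ y
    fibre x y sy≡sx with zero-product (begin
        (y - x) * (y + (x + 1#))  ≡⟨ solve 2 (λ x y → (y :- x) :* (y :+ (x :+ con 1ℤ))
                                                     := y :* (y :+ con 1ℤ) :- x :* (x :+ con 1ℤ)) refl x y ⟩
        s y - s x                 ≡⟨ cong (_- s x) sy≡sx ⟩
        s x - s x                 ≡⟨ solve 1 (λ a → a :- a := con 0ℤ) refl (s x) ⟩
        0#                        ∎)
    ... | inj₁ y-x≡0 = inj₁ (sym (x∙y⁻¹≈ε⇒x≈y y x y-x≡0))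
    ... | inj₂ y+x+1≡0 = inj₂ (sym (trans (+-inverseˡ-unique y (x + 1#) y+x+1≡0) (-a≡a (x + 1#))))

  -x≢x : ∀ {x} → x ≢ 0# → - x ≢ x
  -x≢x {x} x≢0 -x≡x with zero-product (begin
      (1# + 1#) * x  ≡⟨ solve 1 (λ x → (con 1ℤ :+ con 1ℤ) :* x := x :- :- x) refl x ⟩
      x - - x        ≡⟨ cong (λ t → x - t) -x≡x ⟩
      x - x          ≡⟨ solve 1 (λ x → x :- x := con 0ℤ) refl x ⟩
      0#             ∎)
    where open ≡-Reasoning
  ... | inj₁ 2≡0 = 1+1≢0 2≡0
  ... | inj₂ x≡0 = x≢0 x≡0

  count-square-two-to-one : {P : Pred Carrier 0ℓ} (P? : Decidable P) →
    P ⊆ (_≢ 0#) → (∀ {x} → P x → P (- x)) → count P? ≡ 2 ℕ.* count (image? P? λ x → x * x)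
  count-square-two-to-one P? P⊆nonzero P-neg = count-two-to-one P? (λ x → x * x) -_ P-neg
    (-x≢x ∘ P⊆nonzero) (λ {x} _ → solve 1 (λ x → :- x :* :- x := x :* x) refl x)
    (λ _ _ yy≡xx → Sum.map sym sym (x*x≡y*y⇒x≡y⊎x≡-y yy≡xx))

  #nonzero≡2*#square : count nonzero? ≡ 2 ℕ.* count square?
  #nonzero≡2*#square = trans (count-square-two-to-one nonzero? (λ x≢0 → x≢0) -‿≢0)
    (cong (2 ℕ.*_) (count-≐ (image? nonzero? λ x → x * x) square? (image⊆square , square⊆image)))
    where
    image⊆square : Image (_≢ 0#) (λ x → x * x) ⊆ (_≢ 0#) ∩ IsSquare
    image⊆square (w , w≢0 , ww≡y) = (λ y≡0 → *-≢0 w≢0 w≢0 (trans ww≡y y≡0)) , w , ww≡y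
    square⊆image : (_≢ 0#) ∩ IsSquare ⊆ Image (_≢ 0#) (λ x → x * x)
    square⊆image (y≢0 , w , ww≡y) = w , root≢0 ww≡y y≢0 , ww≡y

  #nonzero≡#square+#nonsquare : count nonzero? ≡ count square? ℕ.+ count nonsquare?
  #nonzero≡#square+#nonsquare = trans (count-≐ nonzero? (square? ∪? nonsquare?) (split , join))
    (count-∪ square? nonsquare? λ ((_ , sq) , ¬sq) → ¬sq sq)
    where
    split : (_≢ 0#) ⊆ ((_≢ 0#) ∩ IsSquare) ∪ ∁ IsSquare
    split {x} x≢0 with isSquare? x
    ... | yes sq = inj₁ (x≢0 , sq)
    ... | no ¬sq = inj₂ ¬sq
    join : ((_≢ 0#) ∩ IsSquare) ∪ ∁ IsSquare ⊆ (_≢ 0#)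
    join = [ proj₁ , nonsquare≢0 ]

  #nonsquare≡#square : count nonsquare? ≡ count square?
  #nonsquare≡#square = ℕ.+-cancelˡ-≡ (count square?) _ _ (begin
    count square? ℕ.+ count nonsquare?  ≡⟨ #nonzero≡#square+#nonsquare ⟨
    count nonzero?                      ≡⟨ #nonzero≡2*#square ⟩
    2 ℕ.* count square?                 ≡⟨ cong (count square? ℕ.+_) (ℕ.+-identityʳ (count square?)) ⟩
    count square? ℕ.+ count square?     ∎)
    where open ≡-Reasoning

  nonsquare*nonsquare : ∀ {a b} → ¬ IsSquare a → ¬ IsSquare b → IsSquare (a * b)
  nonsquare*nonsquare {a} {b} ¬sq-a ¬sq-b with isSquare? (a * b)
  ... | yes sq    = sq
  ... | no ¬sq-ab = contradiction (begin
      count square? ℕ.+ 1               ≡⟨ cong (count square? ℕ.+_) (count-singleton b) ⟨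
      count square? ℕ.+ count (b ≟_)    ≡⟨ count-∪ square? (b ≟_) square⊥b ⟨
      count (square? ∪? (b ≟_))         ≤⟨ count-mono (square? ∪? (b ≟_)) (nonsquare? ∘ (a *_)) a*-nonsquare ⟩
      count (nonsquare? ∘ (a *_))       ≡⟨ count-↔ nonsquare? (multiplication-↔ (nonsquare≢0 ¬sq-a)) ⟩
      count nonsquare?                  ≡⟨ #nonsquare≡#square ⟩
      count square?                     ∎) (ℕ.m+1+n≰m (count square?))
    where
    open ℕ.≤-Reasoning
    square⊥b : (_≢ 0#) ∩ IsSquare ⊥ (b ≡_)
    square⊥b ((_ , sq) , b≡x) = ¬sq-b (subst IsSquare (sym b≡x) sq)
    a*-nonsquare : ((_≢ 0#) ∩ IsSquare) ∪ (b ≡_) ⊆ (λ x → ¬ IsSquare (a * x))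
    a*-nonsquare (inj₁ (x≢0 , sq)) = nonsquare*square ¬sq-a x≢0 sq
    a*-nonsquare (inj₂ refl)       = ¬sq-ab

  χ-* : ∀ a b → χ (a * b) ≡ χ a ℤ.* χ b
  χ-* a b with zero-square-or-nonsquare a | zero-square-or-nonsquare b
  ... | inj₁ a≡0 | _ =
    trans (χ-zero (trans (cong (_* b) a≡0) (zeroˡ b))) (cong (ℤ._* χ b) (sym (χ-zero a≡0)))
  ... | _ | inj₁ b≡0 =
    trans (χ-zero (trans (cong (a *_) b≡0) (zeroʳ a)))
      (sym (trans (cong (χ a ℤ.*_) (χ-zero b≡0)) (ℤ.*-zeroʳ (χ a))))
  ... | inj₂ (inj₁ (a≢0 , sq-a)) | inj₂ (inj₁ (b≢0 , sq-b)) =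
    trans (χ-square (*-≢0 a≢0 b≢0) (square*square sq-a sq-b))
      (sym (cong₂ ℤ._*_ (χ-square a≢0 sq-a) (χ-square b≢0 sq-b)))
  ... | inj₂ (inj₁ (a≢0 , sq-a)) | inj₂ (inj₂ ¬sq-b) =
    trans (χ-nonsquare (subst (¬_ ∘ IsSquare) (*-comm b a) (nonsquare*square ¬sq-b a≢0 sq-a)))
      (sym (cong₂ ℤ._*_ (χ-square a≢0 sq-a) (χ-nonsquare ¬sq-b)))
  ... | inj₂ (inj₂ ¬sq-a) | inj₂ (inj₁ (b≢0 , sq-b)) =
    trans (χ-nonsquare (nonsquare*square ¬sq-a b≢0 sq-b))
      (sym (cong₂ ℤ._*_ (χ-nonsquare ¬sq-a) (χ-square b≢0 sq-b)))
  ... | inj₂ (inj₂ ¬sq-a) | inj₂ (inj₂ ¬sq-b) =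
    trans (χ-square (*-≢0 (nonsquare≢0 ¬sq-a) (nonsquare≢0 ¬sq-b)) (nonsquare*nonsquare ¬sq-a ¬sq-b))
      (sym (cong₂ ℤ._*_ (χ-nonsquare ¬sq-a) (χ-nonsquare ¬sq-b)))

  χ-*-square : ∀ {k} → k ≢ 0# → ∀ a → χ (k * k * a) ≡ χ a
  χ-*-square {k} k≢0 a = trans (χ-* (k * k) a)
    (trans (cong (ℤ._* χ a) (χ-square (*-≢0 k≢0 k≢0) (k , refl))) (ℤ.*-identityˡ (χ a)))

  -1-nonsquare : size % 4 ≡ 3 → ¬ IsSquare (- 1#)
  -1-nonsquare size%4≡3 (i , ii≡-1) = %4≡3⇒≢1+4* size%4≡3 (count (image? square? λ x → x * x)) (begin
    size                                                     ≡⟨ size≡1+#nonzero ⟩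
    1 ℕ.+ count nonzero?                                     ≡⟨ cong (1 ℕ.+_) #nonzero≡2*#square ⟩
    1 ℕ.+ 2 ℕ.* count square?                                ≡⟨ cong (λ t → 1 ℕ.+ 2 ℕ.* t) #square≡2*#fourth-power ⟩
    1 ℕ.+ 2 ℕ.* (2 ℕ.* count (image? square? λ x → x * x))  ∎)
    where
    open ≡-Reasoning
    square-neg : ∀ {x} → x ≢ 0# × IsSquare x → - x ≢ 0# × IsSquare (- x)
    square-neg {x} (x≢0 , w , ww≡x) = -‿≢0 x≢0 , i * w , (begin
      (i * w) * (i * w)  ≡⟨ solve 2 (λ i w → (i :* w) :* (i :* w) := (i :* i) :* (w :* w)) refl i w ⟩
      (i * i) * (w * w)  ≡⟨ cong₂ _*_ ii≡-1 ww≡x ⟩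
      - 1# * x           ≡⟨ -1*x≈-x x ⟩
      - x                ∎)
    #square≡2*#fourth-power : count square? ≡ 2 ℕ.* count (image? square? λ x → x * x)
    #square≡2*#fourth-power = count-square-two-to-one square? proj₁ square-neg

  χ-[-1] : size % 4 ≡ 3 → χ (- 1#) ≡ -1ℤ
  χ-[-1] = χ-nonsquare ∘ -1-nonsquare

module ProjectiveLine (F : FiniteField) (size%4≡3 : FiniteField.size F % 4 ≡ 3) where

  open FiniteField F
  open FieldProperties F
  open QuadraticCharacter F (%4≡3⇒%2≡1 {size} size%4≡3)

  ∼-sym : ∀ x y → x ∼ y → y ∼ x
  ∼-sym ((x₁ , x₂) , _) ((y₁ , y₂) , _) (c , c≢0 , y₁≡cx₁ , y₂≡cx₂) =
    c⁻¹ , x*y≡1⇒y≢0 cc⁻¹≡1 , unscale y₁≡cx₁ , unscale y₂≡cx₂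
    where
    c⁻¹ = proj₁ (inv c c≢0)
    cc⁻¹≡1 = proj₂ (inv c c≢0)
    unscale : ∀ {u v} → v ≡ c * u → u ≡ c⁻¹ * v
    unscale {u} refl = sym (x*y≡1⇒y*[x*z]≡z cc⁻¹≡1 u)

  ∼-trans : ∀ x y z → x ∼ y → y ∼ z → x ∼ z
  ∼-trans ((x₁ , x₂) , _) ((_ , _) , _) ((_ , _) , _) (c , c≢0 , refl , refl) (d , d≢0 , refl , refl) =
    d * c , *-≢0 d≢0 c≢0 , sym (*-assoc d c x₁) , sym (*-assoc d c x₂)

  det-scale : ∀ c d x₁ x₂ y₁ y₂ → c * x₁ * (d * y₂) - c * x₂ * (d * y₁) ≡ c * d * (x₁ * y₂ - x₂ * y₁)
  det-scale = solve 6 (λ c d x₁ x₂ y₁ y₂ →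
    c :* x₁ :* (d :* y₂) :- c :* x₂ :* (d :* y₁) := c :* d :* (x₁ :* y₂ :- x₂ :* y₁)) refl

  gProj-∼ : (x x′ y y′ z z′ : NZPair) → x ∼ x′ → y ∼ y′ → z ∼ z′ → gProj x y z ≡ gProj x′ y′ z′
  gProj-∼ x@((x₁ , x₂) , _) x′@((_ , _) , _) y@((y₁ , y₂) , _) y′@((_ , _) , _)
          z@((z₁ , z₂) , _) z′@((_ , _) , _)
          (c , c≢0 , refl , refl) (d , d≢0 , refl , refl) (e , e≢0 , refl , refl) = sym (begin
    gProj x′ y′ z′
      ≡⟨ cong χ (cong₂ _*_ (cong₂ _*_ (det-scale c d x₁ x₂ y₁ y₂) (det-scale d e y₁ y₂ z₁ z₂))
                           (det-scale e c z₁ z₂ x₁ x₂)) ⟩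
    χ (c * d * det x y * (d * e * det y z) * (e * c * det z x))
      ≡⟨ cong χ (solve 6 (λ c d e a b f → c :* d :* a :* (d :* e :* b) :* (e :* c :* f)
                                          := c :* d :* e :* (c :* d :* e) :* (a :* b :* f))
                         refl c d e (det x y) (det y z) (det z x)) ⟩
    χ (c * d * e * (c * d * e) * (det x y * det y z * det z x))
      ≡⟨ χ-*-square (*-≢0 (*-≢0 c≢0 d≢0) e≢0) _ ⟩
    gProj x y z ∎)
    where open ≡-Reasoning

  rep : Maybe Carrier → NZPair
  rep (just u) = (u , - 1#) , -1≢0 ∘ proj₂
  rep nothing  = (1# , 0#) , 1≢0 ∘ proj₁

  φ : NZPair → Maybe Carrier
  φ ((x₁ , x₂) , _) with x₂ ≟ 0#
  ... | yes _   = nothing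
  ... | no x₂≢0 = just (- (proj₁ (inv x₂ x₂≢0) * x₁))

  rep-φ : ∀ x → x ∼ rep (φ x)
  rep-φ ((x₁ , x₂) , x≢0) with x₂ ≟ 0#
  ... | yes x₂≡0 = x₁⁻¹ , x*y≡1⇒y≢0 x₁x₁⁻¹≡1 , sym (trans (*-comm x₁⁻¹ x₁) x₁x₁⁻¹≡1) ,
                   sym (trans (cong (x₁⁻¹ *_) x₂≡0) (zeroʳ x₁⁻¹))
    where
    x₁≢0 : x₁ ≢ 0#
    x₁≢0 x₁≡0 = x≢0 (x₁≡0 , x₂≡0)
    x₁⁻¹ = proj₁ (inv x₁ x₁≢0)
    x₁x₁⁻¹≡1 = proj₂ (inv x₁ x₁≢0)
  ... | no x₂≢0 = - x₂⁻¹ , -‿≢0 (x*y≡1⇒y≢0 x₂x₂⁻¹≡1) , -‿distribˡ-* x₂⁻¹ x₁ ,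
                  trans (cong -_ (sym (trans (*-comm x₂⁻¹ x₂) x₂x₂⁻¹≡1))) (-‿distribˡ-* x₂⁻¹ x₂)
    where
    x₂⁻¹ = proj₁ (inv x₂ x₂≢0)
    x₂x₂⁻¹≡1 = proj₂ (inv x₂ x₂≢0)

  rep-injective : ∀ a b → rep a ∼ rep b → a ≡ b
  rep-injective (just u) (just v) (c , _ , v≡cu , -1≡c*-1) =
    cong just (sym (trans v≡cu (trans (cong (_* u) c≡1) (*-identityˡ u))))
    where
    c≡1 : c ≡ 1#
    c≡1 = sym (-‿injective (trans -1≡c*-1 (x*-1≡-x c)))
  rep-injective (just u) nothing  (c , c≢0 , _ , 0≡c*-1) =
    contradiction (sym (trans 0≡c*-1 (x*-1≡-x c))) (-‿≢0 c≢0)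
  rep-injective nothing  (just v) (c , _ , _ , -1≡c*0) = contradiction (trans -1≡c*0 (zeroʳ c)) -1≢0
  rep-injective nothing  nothing  _ = refl

  φ-rep : ∀ v → φ (rep v) ≡ v
  φ-rep v = sym (rep-injective v (φ (rep v)) (rep-φ (rep v)))

  φ-resp-∼ : ∀ x y → x ∼ y → φ x ≡ φ y
  φ-resp-∼ x y x∼y = rep-injective (φ x) (φ y)
    (∼-trans (rep (φ x)) x (rep (φ y)) (∼-sym x (rep (φ x)) (rep-φ x))
                                         (∼-trans x y (rep (φ y)) x∼y (rep-φ y)))

  φ-injective : ∀ x y → φ x ≡ φ y → x ∼ y
  φ-injective x y φx≡φy = ∼-trans x (rep (φ x)) y (rep-φ x)
    (subst (λ v → rep v ∼ y) (sym φx≡φy) (∼-sym y (rep (φ y)) (rep-φ y)))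

  ePaley⁺≡χ∘det∘rep : ∀ a b → ePaley⁺ a b ≡ χ (det (rep a) (rep b))
  ePaley⁺≡χ∘det∘rep (just u) (just v) =
    cong χ (solve 2 (λ u v → v :- u := u :* :- con 1ℤ :- :- con 1ℤ :* v) refl u v)
  ePaley⁺≡χ∘det∘rep (just u) nothing  =
    trans (sym χ-1) (cong χ (solve 1 (λ u → con 1ℤ := u :* con 0ℤ :- :- con 1ℤ :* con 1ℤ) refl u))
  ePaley⁺≡χ∘det∘rep nothing  (just v) =
    trans (sym (χ-[-1] size%4≡3))
      (cong χ (solve 1 (λ v → :- con 1ℤ := con 1ℤ :* :- con 1ℤ :- con 0ℤ :* v) refl v))
  ePaley⁺≡χ∘det∘rep nothing  nothing  =
    sym (χ-zero (solve 0 (con 1ℤ :* con 0ℤ :- con 0ℤ :* con 1ℤ := con 0ℤ) refl))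

  gPaley≡gProj∘rep : ∀ a b c → gPaley a b c ≡ gProj (rep a) (rep b) (rep c)
  gPaley≡gProj∘rep a b c = begin
    gPaley a b c
      ≡⟨ cong₂ ℤ._*_ (cong₂ ℤ._*_ (ePaley⁺≡χ∘det∘rep a b) (ePaley⁺≡χ∘det∘rep b c))
                     (ePaley⁺≡χ∘det∘rep c a) ⟩
    χ dab ℤ.* χ dbc ℤ.* χ dca
      ≡⟨ cong (ℤ._* χ dca) (χ-* dab dbc) ⟨
    χ (dab * dbc) ℤ.* χ dca
      ≡⟨ χ-* (dab * dbc) dca ⟨
    gProj (rep a) (rep b) (rep c) ∎
    where
    open ≡-Reasoning
    dab = det (rep a) (rep b)
    dbc = det (rep b) (rep c)
    dca = det (rep c) (rep a)

  gPaley∘φ≡gProj : ∀ x y z → gPaley (φ x) (φ y) (φ z) ≡ gProj x y z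
  gPaley∘φ≡gProj x y z = trans (gPaley≡gProj∘rep (φ x) (φ y) (φ z))
    (sym (gProj-∼ x (rep (φ x)) y (rep (φ y)) z (rep (φ z)) (rep-φ x) (rep-φ y) (rep-φ z)))

lemma3p4 : (F : FiniteField) →
    let open FiniteField F in
    IsPrimePower size → size % 4 ≡ 3 →
    ((x x′ y y′ z z′ : NZPair) → x ∼ x′ → y ∼ y′ → z ∼ z′ →
       gProj x y z ≡ gProj x′ y′ z′)
    ×
    Σ (NZPair → Maybe Carrier) (λ φ →
      ((a b : NZPair) → a ∼ b → φ a ≡ φ b) ×
      ((a b : NZPair) → φ a ≡ φ b → a ∼ b) ×
      ((v : Maybe Carrier) → ∃ (λ a → φ a ≡ v)) ×
      ((x y z : NZPair) → ¬ (x ∼ y) → ¬ (y ∼ z) → ¬ (z ∼ x) →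
         gPaley (φ x) (φ y) (φ z) ≡ gProj x y z))
lemma3p4 F _ size%4≡3 =
  gProj-∼ ,
  φ ,
  φ-resp-∼ ,
  φ-injective ,
  (λ v → rep v , φ-rep v) ,
  (λ x y z _ _ _ → gPaley∘φ≡gProj x y z)
  where open ProjectiveLine F size%4≡3
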